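{- Let $F$ be either $\mathbb{Z}/m\mathbb{Z}$ (for a positive integer $m$) or $\mathbb{Q}$, let $M$ be an $F$-module, $s$ a positive integer, $A=\{a_1,\dots,a_k\}\subset M$ with $\operatorname{card}(A)=k\ge1$, and let $A_{r,s}$ be as defined below. Then there exists a unique $F$-linear map $\phi_0:\langle A_{r,s}\rangle\to F$ with $\phi_0(x)=1_F$ for all $x\in A_{r,s}$. Moreover, if $F=\mathbb{Z}/m\mathbb{Z}$, then every element of $A_{r,s}$ has order exactly $m$ in the finite abelian group $\langle A_{r,s}\rangle$.
   Context: Let $e_1,\dots,e_k$ be the canonical basis of $F^k$, $\phi:F^k\to M$ the $F$-linear map with $\phi(e_i)=a_i$, $R_s\subset F^k$ the set of elements $e_{i_1}+\dots+e_{i_s}-e_{j_1}-\dots-e_{j_s}$ (indices not necessarily distinct), $R_s(A)=R_s\cap\ker\phi$, $\langle X\rangle$ the $F$-submodule generated by $X$, and $A_{r,s}=\{\bar e_1,\dots,\bar e_k\}$ the image of $\{e_1,\dots,e_k\}$ in $F^k/\langle R_s(A)\rangle$. -}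

module Defs where

open import Level using (Level; 0ℓ; _⊔_)
open import Data.Nat as ℕ using (ℕ; zero; suc; _<_; _≤_)
import Data.Integer.Properties as ℤP
open import Data.Integer.Divisibility.Signed
  using (_∣_; divides; ∣m∣n⇒∣m+n; ∣m⇒∣-m; ∣n⇒∣m*n; ∣m⇒∣m*n)
open import Data.Integer.Solver using (module +-*-Solver)
import Data.Rational.Properties as ℚP
open import Data.Fin using (Fin; zero; suc; _≟_)
open import Data.Product using (Σ; ∃; _×_; _,_)
open import Data.Unit using (⊤)
open import Relation.Nullary using (¬_; yes; no)
open import Relation.Binary.PropositionalEquality
  using (_≡_; refl; sym; trans; cong; subst)
open import Algebra.Bundles using (CommutativeRing)
open import Algebra.Structures using (IsCommutativeRing)
open import Algebra.Module.Bundles using (Module)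

-- The ring ℤ/mℤ, realised as the setoid ring on ℤ with
-- x ≈ y  iff  m ∣ x - y  (congruence modulo m).

module ZMod (m : ℕ) where

  open import Data.Integer using (ℤ; +_; _+_; _*_; -_; _-_)

  infix 4 _≈_
  record _≈_ (x y : ℤ) : Set where
    constructor mod
    field divides-diff : (+ m) ∣ (x - y)

  private
    open +-*-Solver

    by : ∀ {a b} → a ≡ b → (+ m) ∣ b → (+ m) ∣ a
    by eq d = subst ((+ m) ∣_) (sym eq) d

    ≡⇒≈ : ∀ {x y} → x ≡ y → x ≈ y
    ≡⇒≈ {x} refl = mod (divides (+ 0) (trans (ℤP.+-inverseʳ x) (sym (ℤP.*-zeroˡ (+ m)))))

    ≈-sym : ∀ {x y} → x ≈ y → y ≈ x
    ≈-sym {x} {y} (mod d) = mod (by (solve 2 (λ x y → y :- x := :- (x :- y)) refl x y) (∣m⇒∣-m d))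

    ≈-trans : ∀ {x y z} → x ≈ y → y ≈ z → x ≈ z
    ≈-trans {x} {y} {z} (mod d) (mod e) = mod (
      by (solve 3 (λ x y z → x :- z := (x :- y) :+ (y :- z)) refl x y z) (∣m∣n⇒∣m+n d e))

    +-cong : ∀ {x y u v} → x ≈ y → u ≈ v → (x + u) ≈ (y + v)
    +-cong {x} {y} {u} {v} (mod d) (mod e) = mod (
      by (solve 4 (λ x y u v → (x :+ u) :- (y :+ v) := (x :- y) :+ (u :- v)) refl x y u v)
         (∣m∣n⇒∣m+n d e))

    *-cong : ∀ {x y u v} → x ≈ y → u ≈ v → (x * u) ≈ (y * v)
    *-cong {x} {y} {u} {v} (mod d) (mod e) = mod (
      by (solve 4 (λ x y u v → (x :* u) :- (y :* v) := x :* (u :- v) :+ (x :- y) :* v) refl x y u v)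
         (∣m∣n⇒∣m+n (∣n⇒∣m*n x e) (∣m⇒∣m*n v d)))

    neg-cong : ∀ {x y} → x ≈ y → (- x) ≈ (- y)
    neg-cong {x} {y} (mod d) = mod (by (solve 2 (λ x y → (:- x) :- (:- y) := :- (x :- y)) refl x y) (∣m⇒∣-m d))

  isCommutativeRing : IsCommutativeRing _≈_ _+_ _*_ -_ (+ 0) (+ 1)
  isCommutativeRing = record
    { isRing = record
      { +-isAbelianGroup = record
        { isGroup = record
          { isMonoid = record
            { isSemigroup = record
              { isMagma = record
                { isEquivalence = record { refl = ≡⇒≈ refl ; sym = ≈-sym ; trans = ≈-trans }
                ; ∙-cong = +-cong }
              ; assoc = λ x y z → ≡⇒≈ (ℤP.+-assoc x y z) }
            ; identity = (λ x → ≡⇒≈ (ℤP.+-identityˡ x)) , (λ x → ≡⇒≈ (ℤP.+-identityʳ x)) }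
          ; inverse = (λ x → ≡⇒≈ (ℤP.+-inverseˡ x)) , (λ x → ≡⇒≈ (ℤP.+-inverseʳ x))
          ; ⁻¹-cong = neg-cong }
        ; comm = λ x y → ≡⇒≈ (ℤP.+-comm x y) }
      ; *-cong = *-cong
      ; *-assoc = λ x y z → ≡⇒≈ (ℤP.*-assoc x y z)
      ; *-identity = (λ x → ≡⇒≈ (ℤP.*-identityˡ x)) , (λ x → ≡⇒≈ (ℤP.*-identityʳ x))
      ; distrib = (λ x y z → ≡⇒≈ (ℤP.*-distribˡ-+ x y z)) , (λ x y z → ≡⇒≈ (ℤP.*-distribʳ-+ x y z)) }
    ; *-comm = λ x y → ≡⇒≈ (ℤP.*-comm x y) }

  commutativeRing : CommutativeRing 0ℓ 0ℓ
  commutativeRing = record { isCommutativeRing = isCommutativeRing }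

data FieldChoice : Set where
  ℤmod : (m : ℕ) → 1 ≤ m → FieldChoice
  ℚ-field : FieldChoice

ring : FieldChoice → CommutativeRing 0ℓ 0ℓ
ring (ℤmod m _) = ZMod.commutativeRing m
ring ℚ-field    = ℚP.+-*-commutativeRing

module Setup {mℓ ℓm : Level} (R : CommutativeRing 0ℓ 0ℓ) (M : Module R mℓ ℓm)
             (k : ℕ) (a : Fin k → Module.Carrierᴹ M) (s : ℕ) where

  open CommutativeRing R using (Carrier; _≈_; _+_; _*_; _-_; 0#; 1#)
  open Module M using (Carrierᴹ; _≈ᴹ_; _+ᴹ_; _*ₗ_; 0ᴹ)

  V : Set
  V = Fin k → Carrier

  _≈ᵥ_ : V → V → Set
  x ≈ᵥ y = ∀ j → x j ≈ y j

  0ᵥ : V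
  0ᵥ _ = 0#

  _+ᵥ_ : V → V → V
  (x +ᵥ y) j = x j + y j

  _-ᵥ_ : V → V → V
  (x -ᵥ y) j = x j - y j

  _·ᵥ_ : Carrier → V → V
  (c ·ᵥ x) j = c * x j

  sumV : ∀ {n} → (Fin n → V) → V
  sumV {zero}  f = 0ᵥ
  sumV {suc n} f = f zero +ᵥ sumV (λ t → f (suc t))

  sumM : ∀ {n} → (Fin n → Carrierᴹ) → Carrierᴹ
  sumM {zero}  f = 0ᴹ
  sumM {suc n} f = f zero +ᴹ sumM (λ t → f (suc t))

  e : Fin k → V
  e i j with i ≟ j
  ... | yes _ = 1#
  ... | no  _ = 0#

  φ : V → Carrierᴹ
  φ x = sumM (λ j → x j *ₗ a j)

  rel : (Fin s → Fin k) × (Fin s → Fin k) → V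
  rel (is , js) = sumV (λ t → e (is t)) -ᵥ sumV (λ t → e (js t))

  -- x ∈ ⟨R_s(A)⟩ : x is an F-linear combination of elements of R_s ∩ ker φ
  InSpanRsA : V → Set ℓm
  InSpanRsA x =
    Σ ℕ λ n → Σ (Fin n → Carrier) λ c →
    Σ (Fin n → (Fin s → Fin k) × (Fin s → Fin k)) λ g →
      (∀ t → φ (rel (g t)) ≈ᴹ 0ᴹ) × (x ≈ᵥ sumV (λ t → c t ·ᵥ rel (g t)))

  -- the congruence defining F^k / ⟨R_s(A)⟩
  _~_ : V → V → Set ℓm
  x ~ y = InSpanRsA (x -ᵥ y)

  IsLinearOnQuotient : (V → Carrier) → Set ℓm
  IsLinearOnQuotient f =
    (∀ x y → x ~ y → f x ≈ f y) ×
    (∀ x y → f (x +ᵥ y) ≈ f x + f y) ×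
    (∀ c x → f (c ·ᵥ x) ≈ c * f x)

  -- φ₀ linear on ⟨A_{r,s}⟩ with φ₀(ē_i) = 1
  IsPhi0 : (V → Carrier) → Set ℓm
  IsPhi0 f = IsLinearOnQuotient f × (∀ i → f (e i) ≈ 1#)

  ExistsUniquePhi0 : Set ℓm
  ExistsUniquePhi0 =
    (Σ (V → Carrier) IsPhi0) ×
    (∀ f g → IsPhi0 f → IsPhi0 g → ∀ x → f x ≈ g x)

  natMul : ℕ → V → V
  natMul zero    x = 0ᵥ
  natMul (suc n) x = x +ᵥ natMul n x

  HasOrder : V → ℕ → Set ℓm
  HasOrder x n =
    (1 ≤ n) × (natMul n x ~ 0ᵥ) × (∀ j → 1 ≤ j → j < n → ¬ (natMul j x ~ 0ᵥ))

Conclusion : {mℓ ℓm : Level} (c : FieldChoice) (M : Module (ring c) mℓ ℓm)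
             (k : ℕ) → (Fin k → Module.Carrierᴹ M) → ℕ → Set ℓm
Conclusion (ℤmod m p) M k a s =
  Setup.ExistsUniquePhi0 (ring (ℤmod m p)) M k a s ×
  (∀ i → Setup.HasOrder (ring (ℤmod m p)) M k a s (Setup.e (ring (ℤmod m p)) M k a s i) m)
Conclusion ℚ-field M k a s =
  Setup.ExistsUniquePhi0 (ring ℚ-field) M k a s

-- The map φ₀ is the coordinate sum  σ(x) = x_1 + … + x_k  on F^k.
-- Every generator  e_{i_1}+…+e_{i_s} − e_{j_1}−…−e_{j_s}  of R_s has
-- coordinate sum  s − s = 0, so σ vanishes on ⟨R_s⟩ ⊇ ⟨R_s(A)⟩ and thus
-- descends to the quotient, where it sends every ē_i to 1.  Uniqueness:
-- a linear form on F^k is determined by its values on the basis, since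
-- x = Σ_j x_j e_j.
--
-- For F = ℤ/mℤ, every vector is killed by m, so m·ē_i = 0; conversely,
-- if j·ē_i = 0 then  j = σ(j·e_i) = σ(0) = 0  in ℤ/mℤ, i.e. m ∣ j, so no
-- 1 ≤ j < m kills ē_i (module ModularOrder).

module Submission where

open import Defs
open import Level using (Level; 0ℓ)
open import Data.Nat using (ℕ; zero; suc; _≤_; _<_)
import Data.Nat.Properties as ℕP
import Data.Nat.Divisibility as ℕD
open import Data.Integer as ℤ using (+_)
import Data.Integer.Properties as ℤP
import Data.Integer.Divisibility.Signed as ℤD
open import Data.Fin using (Fin; zero; suc; _≟_; punchIn)
open import Data.Fin.Properties using (punchInᵢ≢i)
open import Data.Product using (_,_)
open import Data.Empty using (⊥-elim)
open import Function using (_∘_)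
open import Relation.Nullary using (¬_; yes; no)
open import Relation.Binary.PropositionalEquality as ≡ using (_≡_; _≢_)
open import Algebra.Bundles using (CommutativeRing)
open import Algebra.Module.Bundles using (Module)

module CoordinateSum {mℓ ℓm : Level} (R : CommutativeRing 0ℓ 0ℓ) (M : Module R mℓ ℓm)
                     (k : ℕ) (a : Fin k → Module.Carrierᴹ M) (s : ℕ) where

  open CommutativeRing R hiding (zero; ring)
  open Setup R M k a s
  open import Algebra.Properties.Semiring.Sum semiring
    using (sum; sum-cong-≋; sum-remove; sum-replicate; sum-replicate-zero; ∑-distrib-+; *-distribˡ-sum)
  open import Algebra.Properties.Monoid.Mult +-monoid using (_×_)
  open import Algebra.Properties.Ring (CommutativeRing.ring R) using (-1*x≈-x)
  open import Algebra.Properties.AbelianGroup +-abelianGroup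
    using () renaming (x≈y⇒x∙y⁻¹≈ε to x≈y⇒x-y≈0; x∙y⁻¹≈ε⇒x≈y to x-y≈0⇒x≈y)
  open import Relation.Binary.Reasoning.Setoid setoid

  sum-supported : ∀ {n} (t : Fin n → Carrier) (i : Fin n) →
                  (∀ j → j ≢ i → t j ≈ 0#) → sum t ≈ t i
  sum-supported {suc n} t i off = begin
    sum t                               ≈⟨ sum-remove t ⟩
    t i + sum (t ∘ punchIn i)           ≈⟨ +-congˡ (sum-cong-≋ (λ j → off _ (punchInᵢ≢i i j))) ⟩
    t i + sum {n} (λ _ → 0#)            ≈⟨ +-congˡ (sum-replicate-zero n) ⟩
    t i + 0#                            ≈⟨ +-identityʳ (t i) ⟩
    t i                                 ∎

  e-diag : ∀ i → e i i ≈ 1#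
  e-diag i with i ≟ i
  ... | yes _  = refl
  ... | no i≢i = ⊥-elim (i≢i ≡.refl)

  e-off : ∀ i j → j ≢ i → e i j ≈ 0#
  e-off i j j≢i with i ≟ j
  ... | yes i≡j = ⊥-elim (j≢i (≡.sym i≡j))
  ... | no _    = refl

  sumV-at : ∀ {n} (g : Fin n → V) l → sumV g l ≈ sum (λ t → g t l)
  sumV-at {zero}  g l = refl
  sumV-at {suc n} g l = +-congˡ (sumV-at (g ∘ suc) l)

  basis-decomposition : ∀ x → x ≈ᵥ sumV (λ j → x j ·ᵥ e j)
  basis-decomposition x l = sym (begin
    sumV (λ j → x j ·ᵥ e j) l    ≈⟨ sumV-at (λ j → x j ·ᵥ e j) l ⟩
    sum (λ j → x j * e j l)      ≈⟨ sum-supported _ l off-l ⟩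
    x l * e l l                  ≈⟨ trans (*-congˡ (e-diag l)) (*-identityʳ (x l)) ⟩
    x l                          ∎)
    where
    off-l : ∀ j → j ≢ l → x j * e j l ≈ 0#
    off-l j j≢l = trans (*-congˡ (e-off j l (j≢l ∘ ≡.sym))) (zeroʳ (x j))

  -- Coordinatewise equal vectors are congruent modulo ⟨R_s(A)⟩
  -- (their difference is the empty combination).
  ≈ᵥ⇒~ : ∀ {x y} → x ≈ᵥ y → x ~ y
  ≈ᵥ⇒~ x≈y = 0 , (λ ()) , (λ ()) , (λ ()) , λ j → x≈y⇒x-y≈0 (x≈y j)

  additive-sumV : (f : V → Carrier) → f 0ᵥ ≈ 0# → (∀ x y → f (x +ᵥ y) ≈ f x + f y) →
                  ∀ {n} (g : Fin n → V) → f (sumV g) ≈ sum (λ t → f (g t))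
  additive-sumV f f0 f+ {zero}  g = f0
  additive-sumV f f0 f+ {suc n} g =
    trans (f+ (g zero) _) (+-congˡ (additive-sumV f f0 f+ (g ∘ suc)))

  linear-on-basis : ∀ f → IsLinearOnQuotient f → ∀ x → f x ≈ sum (λ j → x j * f (e j))
  linear-on-basis f (f~ , f+ , f·) x = begin
    f x                            ≈⟨ f~ _ _ (≈ᵥ⇒~ (basis-decomposition x)) ⟩
    f (sumV (λ j → x j ·ᵥ e j))    ≈⟨ additive-sumV f f0 f+ (λ j → x j ·ᵥ e j) ⟩
    sum (λ j → f (x j ·ᵥ e j))     ≈⟨ sum-cong-≋ (λ j → f· (x j) (e j)) ⟩
    sum (λ j → x j * f (e j))      ∎
    where
    f0 : f 0ᵥ ≈ 0#
    f0 = begin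
      f 0ᵥ             ≈⟨ f~ _ _ (≈ᵥ⇒~ (λ _ → sym (zeroˡ 0#))) ⟩
      f (0# ·ᵥ 0ᵥ)     ≈⟨ f· 0# 0ᵥ ⟩
      0# * f 0ᵥ        ≈⟨ zeroˡ (f 0ᵥ) ⟩
      0#               ∎

  σ : V → Carrier
  σ = sum

  σ-+ : ∀ x y → σ (x +ᵥ y) ≈ σ x + σ y
  σ-+ = ∑-distrib-+

  σ-· : ∀ c x → σ (c ·ᵥ x) ≈ c * σ x
  σ-· c x = sym (*-distribˡ-sum c x)

  σ-0 : σ 0ᵥ ≈ 0#
  σ-0 = sum-replicate-zero k

  σ-- : ∀ x y → σ (x -ᵥ y) ≈ σ x - σ y
  σ-- x y = begin
    σ (x -ᵥ y)                   ≈⟨ ∑-distrib-+ x (λ j → - y j) ⟩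
    σ x + sum (λ j → - y j)      ≈⟨ +-congˡ (sum-cong-≋ (λ j → sym (-1*x≈-x (y j)))) ⟩
    σ x + σ ((- 1#) ·ᵥ y)        ≈⟨ +-congˡ (σ-· (- 1#) y) ⟩
    σ x + - 1# * σ y             ≈⟨ +-congˡ (-1*x≈-x (σ y)) ⟩
    σ x - σ y                    ∎

  σ-e : ∀ i → σ (e i) ≈ 1#
  σ-e i = trans (sum-supported (e i) i (e-off i)) (e-diag i)

  σ-natMul : ∀ n x → σ (natMul n x) ≈ n × σ x
  σ-natMul zero    x = σ-0
  σ-natMul (suc n) x = trans (σ-+ x (natMul n x)) (+-congˡ (σ-natMul n x))

  -- Each generator of R_s has coordinate sum s·1 − s·1 = 0.
  σ-rel : ∀ g → σ (rel g) ≈ 0#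
  σ-rel (is , js) = begin
    σ (ΣE is -ᵥ ΣE js)         ≈⟨ σ-- (ΣE is) (ΣE js) ⟩
    σ (ΣE is) - σ (ΣE js)      ≈⟨ +-congˡ (-‿cong (σ-ΣE js)) ⟩
    σ (ΣE is) - s × 1#         ≈⟨ +-congʳ (σ-ΣE is) ⟩
    s × 1# - s × 1#            ≈⟨ -‿inverseʳ (s × 1#) ⟩
    0#                         ∎
    where
    ΣE : (Fin s → Fin k) → V
    ΣE is = sumV (λ t → e (is t))
    σ-ΣE : ∀ is → σ (ΣE is) ≈ s × 1#
    σ-ΣE is = trans (additive-sumV σ σ-0 σ-+ (e ∘ is))
                    (trans (sum-cong-≋ (σ-e ∘ is)) (sum-replicate s))

  -- Hence σ vanishes on the span of R_s(A) (indeed on that of R_s) …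
  σ-vanishes-on-span : ∀ x → InSpanRsA x → σ x ≈ 0#
  σ-vanishes-on-span x (n , c , g , _ , x≈comb) = begin
    σ x                                  ≈⟨ sum-cong-≋ x≈comb ⟩
    σ (sumV (λ t → c t ·ᵥ rel (g t)))    ≈⟨ additive-sumV σ σ-0 σ-+ (λ t → c t ·ᵥ rel (g t)) ⟩
    sum (λ t → σ (c t ·ᵥ rel (g t)))     ≈⟨ sum-cong-≋ σ-term ⟩
    sum {n} (λ _ → 0#)                   ≈⟨ sum-replicate-zero n ⟩
    0#                                   ∎
    where
    σ-term : ∀ t → σ (c t ·ᵥ rel (g t)) ≈ 0#
    σ-term t = trans (σ-· (c t) (rel (g t))) (trans (*-congˡ (σ-rel (g t))) (zeroʳ (c t)))

  σ-respects-~ : ∀ x y → x ~ y → σ x ≈ σ y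
  σ-respects-~ x y x~y = x-y≈0⇒x≈y (σ x) (σ y) (trans (sym (σ-- x y)) (σ-vanishes-on-span _ x~y))

  σ-isPhi0 : IsPhi0 σ
  σ-isPhi0 = (σ-respects-~ , σ-+ , σ-·) , σ-e

  phi0-is-σ : ∀ f → IsPhi0 f → ∀ x → f x ≈ σ x
  phi0-is-σ f (f-linear , f-e) x =
    trans (linear-on-basis f f-linear x)
          (sum-cong-≋ (λ j → trans (*-congˡ (f-e j)) (*-identityʳ (x j))))

  existsUniquePhi0 : ExistsUniquePhi0
  existsUniquePhi0 =
    (σ , σ-isPhi0) , λ f g f-phi0 g-phi0 x → trans (phi0-is-σ f f-phi0 x) (sym (phi0-is-σ g g-phi0 x))

module ModularOrder {mℓ ℓm : Level} (m : ℕ) (1≤m : 1 ≤ m) (M : Module (ring (ℤmod m 1≤m)) mℓ ℓm)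
                    (k : ℕ) (a : Fin k → Module.Carrierᴹ M) (s : ℕ) where

  R : CommutativeRing 0ℓ 0ℓ
  R = ring (ℤmod m 1≤m)

  open CommutativeRing R using (_≈_; +-monoid; reflexive; trans; sym)
  open import Algebra.Properties.Monoid.Mult +-monoid using (_×_; ×-congʳ)
  open Setup R M k a s
  open CoordinateSum R M k a s using (σ; σ-0; σ-e; σ-natMul; σ-respects-~; ≈ᵥ⇒~)

  ×≡* : ∀ n y → n × y ≡ + n ℤ.* y
  ×≡* zero    y = ≡.sym (ℤP.*-zeroˡ y)
  ×≡* (suc n) y = begin
    y ℤ.+ n × y              ≡⟨ ≡.cong (λ w → y ℤ.+ w) (×≡* n y) ⟩
    y ℤ.+ + n ℤ.* y          ≡⟨ ≡.cong (λ w → w ℤ.+ + n ℤ.* y) (≡.sym (ℤP.*-identityˡ y)) ⟩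
    + 1 ℤ.* y ℤ.+ + n ℤ.* y  ≡⟨ ≡.sym (ℤP.*-distribʳ-+ y (+ 1) (+ n)) ⟩
    + suc n ℤ.* y            ∎
    where open ≡.≡-Reasoning

  m×≈0 : ∀ y → m × y ≈ + 0
  m×≈0 y = ZMod.mod (ℤD.divides y (begin
    m × y ℤ.- + 0     ≡⟨ ℤP.+-identityʳ (m × y) ⟩
    m × y             ≡⟨ ×≡* m y ⟩
    + m ℤ.* y         ≡⟨ ℤP.*-comm (+ m) y ⟩
    y ℤ.* + m         ∎))
    where open ≡.≡-Reasoning

  ≈0⇒m∣ : ∀ j → + j ≈ + 0 → m ℕD.∣ j
  ≈0⇒m∣ j (ZMod.mod m∣j-0) = ℤD.∣⇒∣ᵤ (≡.subst (ℤD._∣_ (+ m)) (ℤP.+-identityʳ (+ j)) m∣j-0)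

  σ-natMul-e : ∀ j i → σ (natMul j (e i)) ≈ + j
  σ-natMul-e j i = trans (σ-natMul j (e i)) (trans (×-congʳ j (σ-e i)) (reflexive j×1≡j))
    where
    j×1≡j : j × + 1 ≡ + j
    j×1≡j = ≡.trans (×≡* j (+ 1)) (ℤP.*-identityʳ (+ j))

  natMul-m≈0 : ∀ x → natMul m x ≈ᵥ 0ᵥ
  natMul-m≈0 x l = trans (reflexive (natMul-at m l)) (m×≈0 (x l))
    where
    natMul-at : ∀ n l → natMul n x l ≡ n × x l
    natMul-at zero    l = ≡.refl
    natMul-at (suc n) l = ≡.cong (λ w → x l ℤ.+ w) (natMul-at n l)

  -- No 1 ≤ j < m kills ē_i: otherwise j = σ(j·e_i) = σ(0) = 0 in ℤ/mℤ.
  no-smaller-order : ∀ i j → 1 ≤ j → j < m → ¬ (natMul j (e i) ~ 0ᵥ)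
  no-smaller-order i (suc j) _ j<m j·eᵢ~0 = ℕP.<⇒≱ j<m (ℕD.∣⇒≤ (≈0⇒m∣ (suc j) suc-j≈0))
    where
    suc-j≈0 : + suc j ≈ + 0
    suc-j≈0 = trans (sym (σ-natMul-e (suc j) i))
                    (trans (σ-respects-~ _ _ j·eᵢ~0) σ-0)

  order : ∀ i → HasOrder (e i) m
  order i = 1≤m , ≈ᵥ⇒~ (natMul-m≈0 (e i)) , no-smaller-order i

lemma11 : {mℓ ℓm : Level} (c : FieldChoice) (M : Module (ring c) mℓ ℓm)
          (s : ℕ) → 1 ≤ s →
          (k : ℕ) → 1 ≤ k →
          (a : Fin k → Module.Carrierᴹ M) →
          (∀ i j → Module._≈ᴹ_ M (a i) (a j) → i ≡ j) →
          Conclusion c M k a s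
lemma11 (ℤmod m 1≤m) M s _ k _ a _ =
  CoordinateSum.existsUniquePhi0 (ring (ℤmod m 1≤m)) M k a s , ModularOrder.order m 1≤m M k a s
lemma11 ℚ-field M s _ k _ a _ = CoordinateSum.existsUniquePhi0 (ring ℚ-field) M k a s
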